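{- Let $r>0$ be a real number with $r\neq1$, and let $F=\left(\frac{1}{1-r},\frac{r}{r-1}\right)\in\mathbb R^2$. For an integer $n\ge0$ put $x=\sum_{i=0}^n r^i$ and $S=(x,0)$. Then the line through $F$ and $S$ meets the $y$-axis at the point $S'=(0,y)$ with $y=\sum_{i=0}^n r^{ -i}$. (That is, the perspective projection from the $x$-axis onto the $y$-axis with focal point $F$ maps $(x,0)$ to $(0,y)$.) -}

module Defs where

open import Level using (Level; suc; _⊔_)
open import Data.Nat using (ℕ; zero) renaming (suc to 1+)
open import Data.Product using (_×_; ∃)
open import Relation.Binary.PropositionalEquality using (_≡_; _≢_)
open import Relation.Binary.Structures using (IsStrictTotalOrder)
open import Algebra.Structures using (IsCommutativeRing)

-- An ordered field (the real numbers are one).  Equality is propositional.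
-- The inverse is total (value at 0 irrelevant); it is only specified on x ≢ 0#.
record OrderedField (c ℓ : Level) : Set (suc (c ⊔ ℓ)) where
  infixl 6 _+_ _-_
  infixl 7 _*_
  infix 4 _<_
  field
    Carrier  : Set c
    _+_ _*_  : Carrier → Carrier → Carrier
    -_       : Carrier → Carrier
    0# 1#    : Carrier
    _⁻¹      : Carrier → Carrier
    _<_      : Carrier → Carrier → Set ℓ
    isCommutativeRing : IsCommutativeRing _≡_ _+_ _*_ -_ 0# 1#
    0≢1      : 0# ≢ 1#
    ⁻¹-inverse : ∀ x → x ≢ 0# → x * (x ⁻¹) ≡ 1#
    isStrictTotalOrder : IsStrictTotalOrder _≡_ _<_
    +-mono-<  : ∀ {x y} z → x < y → x + z < y + z
    *-pos     : ∀ {x y} → 0# < x → 0# < y → 0# < x * y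

  _-_ : Carrier → Carrier → Carrier
  x - y = x + (- y)

  _/_ : Carrier → Carrier → Carrier
  x / y = x * (y ⁻¹)

  _^_ : Carrier → ℕ → Carrier
  x ^ zero  = 1#
  x ^ (1+ n) = x * (x ^ n)

  sum0to : (ℕ → Carrier) → ℕ → Carrier
  sum0to f zero     = f zero
  sum0to f (1+ n)   = sum0to f n + f (1+ n)

  Point : Set c
  Point = Carrier × Carrier

  OnLine : Point → Point → Point → Set c
  OnLine (a₁ Data.Product., a₂) (b₁ Data.Product., b₂) (p₁ Data.Product., p₂) =
    ∃ λ t → (p₁ ≡ a₁ + t * (b₁ - a₁)) × (p₂ ≡ a₂ + t * (b₂ - a₂))

module Submission where

-- Write a = 1 - r, s = r⁻¹, u = 1/a, v = r/(r - 1), x = Σᵢ₌₀ⁿ rⁱ, y = Σᵢ₌₀ⁿ sⁱ,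
-- so that F = (u , v) and S = (x , 0).  The line through F and S meets the
-- y-axis at the parameter t = sⁿ⁺¹:
--   * a·(u + t(x - u)) = a·((1 - t)u + tx) = (1 - t) + t(1 - rⁿ⁺¹) = 0,
--     using the geometric sum a·x = 1 - rⁿ⁺¹ and t·rⁿ⁺¹ = 1;
--   * the height there is v + t(0 - v) = (1 - t)v = (1 - s)·y·v = y,
--     using the geometric sum (1 - s)·y = 1 - t and (1 - s)·v = 1.
-- The file first collects ring identities (telescoping, the affine form of a
-- point on a line, geometric sums, powers of inverses) and field facts
-- (cancellation, division), then proves the general fact that a line whose
-- first point is off the y-axis and which reaches the y-axis at a parameter t
-- meets it exactly once, and finally verifies the two computations above.

open import Defs
open import Data.Nat using (ℕ; zero; suc)
open import Data.Product using (_×_; _,_)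
open import Relation.Binary.PropositionalEquality
  using (_≡_; _≢_; refl; sym; trans; cong; cong₂; module ≡-Reasoning)
open import Algebra.Bundles using (CommutativeRing)
open import Algebra.Structures using (IsCommutativeRing)
open import Relation.Binary.Structures using (IsStrictTotalOrder)
import Algebra.Properties.CommutativeSemigroup as CommutativeSemigroupProperties

module OrderedFieldTheory {c ℓ} (K : OrderedField c ℓ) where
  open OrderedField K
  open IsCommutativeRing isCommutativeRing
    using (+-assoc; +-identityˡ; +-identityʳ; *-identityˡ; *-identityʳ; *-assoc; *-comm;
           distribˡ; distribʳ; zeroˡ; zeroʳ; -‿inverseˡ; -‿inverseʳ)
  open ≡-Reasoning

  commutativeRing : CommutativeRing c c
  commutativeRing = record { isCommutativeRing = isCommutativeRing }

  open CommutativeRing commutativeRing using (ring; +-commutativeSemigroup; *-commutativeSemigroup)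
  open import Algebra.Properties.Ring ring
    using (+-cancelˡ; x[y-z]≈xy-xz; [y-z]x≈yx-zx; x∙y⁻¹≈ε⇒x≈y)
  module +-Comm = CommutativeSemigroupProperties +-commutativeSemigroup
  module *-Comm = CommutativeSemigroupProperties *-commutativeSemigroup
  open IsStrictTotalOrder isStrictTotalOrder using (irrefl)

  one-minus-* : ∀ a b → (1# - a) * b ≡ b - a * b
  one-minus-* a b = begin
    (1# - a) * b     ≡⟨ [y-z]x≈yx-zx b 1# a ⟩
    1# * b - a * b   ≡⟨ cong (_- a * b) (*-identityˡ b) ⟩
    b - a * b        ∎

  telescope : ∀ a b d → (a - b) + (b - d) ≡ a - d
  telescope a b d = begin
    (a - b) + (b - d)    ≡⟨ +-assoc a (- b) (b - d) ⟩
    a + (- b + (b - d))  ≡⟨ cong (a +_) (sym (+-assoc (- b) b (- d))) ⟩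
    a + ((- b + b) - d)  ≡⟨ cong (λ z → a + (z - d)) (-‿inverseˡ b) ⟩
    a + (0# - d)         ≡⟨ cong (a +_) (+-identityˡ (- d)) ⟩
    a - d                ∎

  affine : ∀ a b t → a + t * (b - a) ≡ (1# - t) * a + t * b
  affine a b t = begin
    a + t * (b - a)          ≡⟨ cong (a +_) (x[y-z]≈xy-xz t b a) ⟩
    a + (t * b - t * a)      ≡⟨ +-Comm.x∙yz≈xz∙y a (t * b) (- (t * a)) ⟩
    (a - t * a) + t * b      ≡⟨ cong (_+ t * b) (sym (one-minus-* t a)) ⟩
    (1# - t) * a + t * b     ∎

  geometricSum : ∀ q n → (1# - q) * sum0to (q ^_) n ≡ 1# - q ^ suc n
  geometricSum q zero = begin
    (1# - q) * 1#  ≡⟨ *-identityʳ (1# - q) ⟩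
    1# - q         ≡⟨ cong (λ z → 1# - z) (sym (*-identityʳ q)) ⟩
    1# - q * 1#    ∎
  geometricSum q (suc n) = begin
    (1# - q) * (sum0to (q ^_) n + q ^ suc n)
      ≡⟨ distribˡ (1# - q) (sum0to (q ^_) n) (q ^ suc n) ⟩
    (1# - q) * sum0to (q ^_) n + (1# - q) * q ^ suc n
      ≡⟨ cong₂ _+_ (geometricSum q n) (one-minus-* q (q ^ suc n)) ⟩
    (1# - q ^ suc n) + (q ^ suc n - q ^ suc (suc n))
      ≡⟨ telescope 1# (q ^ suc n) (q ^ suc (suc n)) ⟩
    1# - q ^ suc (suc n) ∎

  ^-inverse : ∀ {a b} → a * b ≡ 1# → ∀ n → a ^ n * b ^ n ≡ 1#
  ^-inverse ab≡1 zero = *-identityˡ 1#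
  ^-inverse {a} {b} ab≡1 (suc n) = begin
    (a * a ^ n) * (b * b ^ n)   ≡⟨ *-Comm.interchange a (a ^ n) b (b ^ n) ⟩
    (a * b) * (a ^ n * b ^ n)   ≡⟨ cong₂ _*_ ab≡1 (^-inverse ab≡1 n) ⟩
    1# * 1#                     ≡⟨ *-identityˡ 1# ⟩
    1#                          ∎

  pos⇒≢0 : ∀ {a} → 0# < a → a ≢ 0#
  pos⇒≢0 0<a a≡0 = irrefl (sym a≡0) 0<a

  difference-≢0 : ∀ {a b} → a ≢ b → a - b ≢ 0#
  difference-≢0 {a} {b} a≢b a-b≡0 = a≢b (x∙y⁻¹≈ε⇒x≈y a b a-b≡0)

  unit-≢0 : ∀ {a b} → a * b ≡ 1# → a ≢ 0#
  unit-≢0 {a} {b} ab≡1 a≡0 = 0≢1 (begin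
    0#      ≡⟨ sym (zeroˡ b) ⟩
    0# * b  ≡⟨ cong (_* b) (sym a≡0) ⟩
    a * b   ≡⟨ ab≡1 ⟩
    1#      ∎)

  ⁻¹-inverseˡ : ∀ {a} → a ≢ 0# → a ⁻¹ * a ≡ 1#
  ⁻¹-inverseˡ {a} a≢0 = trans (*-comm (a ⁻¹) a) (⁻¹-inverse a a≢0)

  /-*-cancel : ∀ {a} b → a ≢ 0# → (b / a) * a ≡ b
  /-*-cancel {a} b a≢0 = begin
    (b * a ⁻¹) * a  ≡⟨ *-assoc b (a ⁻¹) a ⟩
    b * (a ⁻¹ * a)  ≡⟨ cong (b *_) (⁻¹-inverseˡ a≢0) ⟩
    b * 1#          ≡⟨ *-identityʳ b ⟩
    b               ∎

  *-cancelʳ-≢0 : ∀ {a b d} → d ≢ 0# → a * d ≡ b * d → a ≡ b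
  *-cancelʳ-≢0 {a} {b} {d} d≢0 ad≡bd = begin
    a                ≡⟨ sym (/-*-cancel a d≢0) ⟩
    (a * d ⁻¹) * d   ≡⟨ *-Comm.xy∙z≈xz∙y a (d ⁻¹) d ⟩
    (a * d) * d ⁻¹   ≡⟨ cong (_* d ⁻¹) ad≡bd ⟩
    (b * d) * d ⁻¹   ≡⟨ *-Comm.xy∙z≈xz∙y b d (d ⁻¹) ⟩
    (b * d ⁻¹) * d   ≡⟨ /-*-cancel b d≢0 ⟩
    b                ∎

  yAxisCrossing : ∀ a₁ a₂ b₁ b₂ t h → a₁ ≢ 0# →
    a₁ + t * (b₁ - a₁) ≡ 0# → a₂ + t * (b₂ - a₂) ≡ h →
    (a₁ , a₂) ≢ (b₁ , b₂) × OnLine (a₁ , a₂) (b₁ , b₂) (0# , h)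
      × (∀ h′ → OnLine (a₁ , a₂) (b₁ , b₂) (0# , h′) → h′ ≡ h)
  yAxisCrossing a₁ a₂ b₁ b₂ t h a₁≢0 crosses height =
    A≢B , (t , sym crosses , sym height) , unique
    where
    -- The line is not parallel to the y-axis: otherwise it would stay at a₁.
    notVertical : b₁ - a₁ ≢ 0#
    notVertical d≡0 = a₁≢0 (begin
      a₁                  ≡⟨ sym (+-identityʳ a₁) ⟩
      a₁ + 0#             ≡⟨ cong (a₁ +_) (sym (zeroʳ t)) ⟩
      a₁ + t * 0#         ≡⟨ cong (λ d → a₁ + t * d) (sym d≡0) ⟩
      a₁ + t * (b₁ - a₁)  ≡⟨ crosses ⟩
      0#                  ∎)

    A≢B : (a₁ , a₂) ≢ (b₁ , b₂)
    A≢B refl = notVertical (-‿inverseʳ a₁)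

    unique : ∀ h′ → OnLine (a₁ , a₂) (b₁ , b₂) (0# , h′) → h′ ≡ h
    unique h′ (t′ , crosses′ , height′) = begin
      h′                    ≡⟨ height′ ⟩
      a₂ + t′ * (b₂ - a₂)   ≡⟨ cong (λ τ → a₂ + τ * (b₂ - a₂)) t′≡t ⟩
      a₂ + t * (b₂ - a₂)    ≡⟨ height ⟩
      h                     ∎
      where
      t′≡t : t′ ≡ t
      t′≡t = *-cancelʳ-≢0 notVertical
               (+-cancelˡ a₁ (t′ * (b₁ - a₁)) (t * (b₁ - a₁))
                 (trans (sym crosses′) (sym crosses)))

  module Perspective (r : Carrier) (0<r : 0# < r) (r≢1 : r ≢ 1#) (n : ℕ) where
    s a u v x y t : Carrier
    s = r ⁻¹
    a = 1# - r
    u = 1# / a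
    v = r / (r - 1#)
    x = sum0to (λ i → r ^ i) n
    y = sum0to (λ i → s ^ i) n
    t = s ^ suc n                  -- parameter of the crossing with the y-axis

    r≢0 : r ≢ 0#
    r≢0 = pos⇒≢0 0<r

    a≢0 : a ≢ 0#
    a≢0 = difference-≢0 (λ 1≡r → r≢1 (sym 1≡r))

    sr≡1 : s * r ≡ 1#
    sr≡1 = ⁻¹-inverseˡ r≢0

    ua≡1 : u * a ≡ 1#
    ua≡1 = /-*-cancel 1# a≢0

    u≢0 : u ≢ 0#
    u≢0 = unit-≢0 ua≡1

    -- v is the inverse of 1 - s, since (1 - s)·r = r - 1.
    [1-s]v≡1 : (1# - s) * v ≡ 1#
    [1-s]v≡1 = *-cancelʳ-≢0 r≢0 (begin
      ((1# - s) * v) * r  ≡⟨ *-Comm.xy∙z≈xz∙y (1# - s) v r ⟩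
      ((1# - s) * r) * v  ≡⟨ cong (_* v) (one-minus-* s r) ⟩
      (r - s * r) * v     ≡⟨ cong (λ z → (r - z) * v) sr≡1 ⟩
      (r - 1#) * v        ≡⟨ *-comm (r - 1#) v ⟩
      v * (r - 1#)        ≡⟨ /-*-cancel r (difference-≢0 r≢1) ⟩
      r                   ≡⟨ sym (*-identityˡ r) ⟩
      1# * r              ∎)

    crossing : u + t * (x - u) ≡ 0#
    crossing = *-cancelʳ-≢0 a≢0 (begin
      (u + t * (x - u)) * a
        ≡⟨ cong (_* a) (affine u x t) ⟩
      ((1# - t) * u + t * x) * a
        ≡⟨ distribʳ a ((1# - t) * u) (t * x) ⟩
      ((1# - t) * u) * a + (t * x) * a
        ≡⟨ cong₂ _+_ (*-assoc (1# - t) u a) (*-Comm.xy∙z≈x∙zy t x a) ⟩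
      (1# - t) * (u * a) + t * (a * x)
        ≡⟨ cong₂ (λ p q → (1# - t) * p + t * q) ua≡1 (geometricSum r n) ⟩
      (1# - t) * 1# + t * (1# - r ^ suc n)
        ≡⟨ cong₂ _+_ (*-identityʳ (1# - t)) (x[y-z]≈xy-xz t 1# (r ^ suc n)) ⟩
      (1# - t) + (t * 1# - t * r ^ suc n)
        ≡⟨ cong₂ (λ p q → (1# - t) + (p - q)) (*-identityʳ t) (^-inverse sr≡1 (suc n)) ⟩
      (1# - t) + (t - 1#)
        ≡⟨ telescope 1# t 1# ⟩
      1# - 1#
        ≡⟨ -‿inverseʳ 1# ⟩
      0#
        ≡⟨ sym (zeroˡ a) ⟩
      0# * a ∎)

    height : v + t * (0# - v) ≡ y
    height = begin
      v + t * (0# - v)        ≡⟨ affine v 0# t ⟩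
      (1# - t) * v + t * 0#   ≡⟨ cong ((1# - t) * v +_) (zeroʳ t) ⟩
      (1# - t) * v + 0#       ≡⟨ +-identityʳ ((1# - t) * v) ⟩
      (1# - t) * v            ≡⟨ cong (_* v) (sym (geometricSum s n)) ⟩
      ((1# - s) * y) * v      ≡⟨ *-Comm.xy∙z≈y∙xz (1# - s) y v ⟩
      y * ((1# - s) * v)      ≡⟨ cong (y *_) [1-s]v≡1 ⟩
      y * 1#                  ≡⟨ *-identityʳ y ⟩
      y                       ∎

mainTheorem5 : ∀ {c ℓ} (K : OrderedField c ℓ) → let open OrderedField K in
    ∀ (r : Carrier) → 0# < r → r ≢ 1# → (n : ℕ) →
    let F = ((1# / (1# - r)) , (r / (r - 1#)))
        x = sum0to (λ i → r ^ i) n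
        S = (x , 0#)
        y = sum0to (λ i → (r ⁻¹) ^ i) n
    in F ≢ S × OnLine F S (0# , y) × (∀ y′ → OnLine F S (0# , y′) → y′ ≡ y)
mainTheorem5 K r 0<r r≢1 n = yAxisCrossing u v x 0# t y u≢0 crossing height
  where
  open OrderedField K using (0#)
  open OrderedFieldTheory K
  open Perspective r 0<r r≢1 n
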